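{- Let $Y=\{\mathbf{y}_1,\dots,\mathbf{y}_l\}\subset\{0,1\}^m$ be a set of vectors and $\mathbf{c}^*\in\{0,1\}^m$ a vector, and let $d^*=\max_{\mathbf{y}\in Y}d_H(\mathbf{y},\mathbf{c}^*)$. For any $r\in\mathbb{N}$ with $r>2$, there exist indices $i_1,\dots,i_r\in\{1,\dots,l\}$ such that for every $\mathbf{x}\in Y$ and every subset $P\subseteq Q_{i_1,\dots,i_r}$, \[d_H^P(\mathbf{x},\mathbf{y}_{i_1})-d_H^P(\mathbf{x},\mathbf{c}^*)\le\frac{1}{r-1}d^*,\] where $Q_{i_1,\dots,i_r}=\{j\in\{1,\dots,m\}:\mathbf{y}_{i_1}[j]=\mathbf{y}_{i_2}[j]=\dots=\mathbf{y}_{i_r}[j]\}$.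
   Context: $d_H$ is Hamming distance on $\{0,1\}^m$. For $P\subseteq\{1,\dots,m\}$, the Hamming distance restricted to $P$ is $d_H^P(\mathbf{x},\mathbf{y})=\sum_{i\in P}|x_i-y_i|$. -}

module Defs where

open import Data.Nat using (ℕ; _+_; _⊔_)
open import Data.Bool using (Bool; true; false; if_then_else_; _∧_; _xor_)
open import Data.Fin using (Fin)
open import Data.Fin.Subset using (Subset; ⊤)
open import Data.Vec using (lookup; tabulate; foldr)
open import Relation.Binary.PropositionalEquality using (_≡_)

-- binary vectors of length m: {0,1}^m, with 0 = false, 1 = true
BinVec : ℕ → Set
BinVec m = Fin m → Bool

Σ-Fin : {n : ℕ} → (Fin n → ℕ) → ℕ
Σ-Fin {n} f = foldr (λ _ → ℕ) _+_ 0 (tabulate f)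

-- maximum over Fin n (0 for n = 0)
max-Fin : {n : ℕ} → (Fin n → ℕ) → ℕ
max-Fin {n} f = foldr (λ _ → ℕ) _⊔_ 0 (tabulate f)

dHP : {m : ℕ} → Subset m → BinVec m → BinVec m → ℕ
dHP P x y = Σ-Fin (λ j → if lookup P j ∧ (x j xor y j) then 1 else 0)

dH : {m : ℕ} → BinVec m → BinVec m → ℕ
dH x y = dHP ⊤ x y

InQ : {m l r : ℕ} → (Fin l → BinVec m) → (Fin r → Fin l) → Fin r → Fin m → Set
InQ y ι k₁ j = ∀ k → y (ι k) j ≡ y (ι k₁) j

module Submission where

-- Idea of the proof.  Write A i = { j : y_i[j] ≠ c*[j] } for the set of positions
-- where y_i disagrees with c*, so that |A i| = d_H(y_i, c*) ≤ d*.  Set R = r - 1.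
--
-- (1) A greedy selection lemma about any family of sets A i of size ≤ D: there
--     are indices i_0, …, i_R such that, writing I = A i_0 ∩ … ∩ A i_R, every
--     a satisfies  R · |I \ A a| ≤ D.  Start with one index; while some a
--     violates the bound, prepend it.  The potential  n·D + R·|I|  (n = number
--     of chosen indices) starts ≤ (R+1)·D and never increases, since adding a
--     violating a removes the more than D/R positions of I \ A a from I.  After
--     R additions R·|I| ≤ 0, so the bound holds; once it holds, prepending
--     further indices keeps it, as I only shrinks.
-- (2) A pointwise triangle inequality with defect: on a position of P ⊆ Q where
--     y_a differs from y_{i_0} but agrees with c*, all chosen y_{i_k} (which
--     agree there) differ from c*, i.e. the position lies in I \ A a.  Summing,
--     d_H^P(y_a, y_{i_0}) ≤ d_H^P(y_a, c*) + |I \ A a|, and multiplying by R and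
--     applying (1) gives the theorem.

open import Defs
open import Data.Nat using (ℕ; _<_; _≤_; _*_; _+_; _∸_; z≤n; s≤s; zero; suc)
open import Data.Nat.Properties
  using ( ≤-trans; ≤-refl; ≤-reflexive; <⇒≤; ≰⇒>; _≤?_; module ≤-Reasoning
        ; +-mono-≤; +-monoˡ-≤; +-monoʳ-≤; *-monoʳ-≤; +-assoc; +-comm; +-identityʳ
        ; *-distribˡ-+; +-commutativeSemigroup; m≤m⊔n; m≤n⊔m; m≤n+m; +-cancelˡ-≤ )
open import Algebra.Properties.CommutativeSemigroup +-commutativeSemigroup
  using () renaming (interchange to +-interchange)
open import Data.Fin using (Fin; fromℕ<)
import Data.Fin as Fin
open import Data.Fin.Subset using (Subset; _∈_)
open import Data.Fin.Properties using (all?; ¬∀⟶∃¬)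
open import Data.Bool using (Bool; true; false; if_then_else_; _∧_; _xor_; not)
open import Data.Bool.Properties using (∧-identityʳ; xor-assoc; xor-comm; xor-same)
open import Data.Vec using (Vec; []; _∷_; lookup; foldr)
open import Data.Vec.Properties using (tabulate-cong; lookup⇒[]=; lookup-replicate)
open import Data.Product using (Σ; _,_; proj₁; proj₂)
open import Data.Sum using (_⊎_; inj₁; inj₂)
open import Relation.Binary.PropositionalEquality
  using (_≡_; refl; sym; trans; cong; subst; module ≡-Reasoning)
open import Relation.Nullary using (Dec; yes; no; ¬_)

ind : Bool → ℕ
ind b = if b then 1 else 0

count : {m : ℕ} → (Fin m → Bool) → ℕ
count f = Σ-Fin (λ j → ind (f j))

Σ-Fin-mono : ∀ {n} (f g : Fin n → ℕ) → (∀ j → f j ≤ g j) → Σ-Fin f ≤ Σ-Fin g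
Σ-Fin-mono {zero}  f g f≤g = z≤n
Σ-Fin-mono {suc n} f g f≤g =
  +-mono-≤ (f≤g Fin.zero) (Σ-Fin-mono (λ j → f (Fin.suc j)) (λ j → g (Fin.suc j)) (λ j → f≤g (Fin.suc j)))

Σ-Fin-cong : ∀ {n} (f g : Fin n → ℕ) → (∀ j → f j ≡ g j) → Σ-Fin f ≡ Σ-Fin g
Σ-Fin-cong f g f≗g = cong (foldr (λ _ → ℕ) _+_ 0) (tabulate-cong f≗g)

Σ-Fin-+ : ∀ {n} (f g : Fin n → ℕ) → Σ-Fin (λ j → f j + g j) ≡ Σ-Fin f + Σ-Fin g
Σ-Fin-+ {zero}  f g = refl
Σ-Fin-+ {suc n} f g =
  trans (cong ((f Fin.zero + g Fin.zero) +_) (Σ-Fin-+ (λ j → f (Fin.suc j)) (λ j → g (Fin.suc j))))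
        (+-interchange (f Fin.zero) (g Fin.zero) _ _)

dH-as-count : ∀ {m} (x z : BinVec m) → dH x z ≡ count (λ j → x j xor z j)
dH-as-count x z = Σ-Fin-cong _ _ (λ j → cong (λ p → ind (p ∧ (x j xor z j))) (lookup-replicate j true))

max-Fin-≥ : ∀ {n} (f : Fin n → ℕ) i → f i ≤ max-Fin f
max-Fin-≥ f Fin.zero    = m≤m⊔n _ _
max-Fin-≥ f (Fin.suc i) = ≤-trans (max-Fin-≥ (λ j → f (Fin.suc j)) i) (m≤n⊔m (f Fin.zero) _)

count-split : ∀ {m} (g f : Fin m → Bool) →
  count (λ j → g j ∧ f j) + count (λ j → f j ∧ not (g j)) ≡ count f
count-split g f =
  trans (sym (Σ-Fin-+ (λ j → ind (g j ∧ f j)) (λ j → ind (f j ∧ not (g j)))))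
        (Σ-Fin-cong _ _ (λ j → split (g j) (f j)))
  where
  split : ∀ x b → ind (x ∧ b) + ind (b ∧ not x) ≡ ind b
  split true  true  = refl
  split true  false = refl
  split false true  = refl
  split false false = refl

module GreedySelection {m l : ℕ} (A : Fin l → Fin m → Bool) (D R : ℕ)
                       (small : ∀ i → count (A i) ≤ D) where

  ⋂ : ∀ {n} → Vec (Fin l) n → Fin m → Bool
  ⋂ []      j = true
  ⋂ (i ∷ v) j = A i j ∧ ⋂ v j

  Excess : ∀ {n} → Fin l → Vec (Fin l) n → Fin m → Bool
  Excess a v j = ⋂ v j ∧ not (A a j)

  Balanced : ∀ {n} → Vec (Fin l) n → Set
  Balanced v = ∀ a → R * count (Excess a v) ≤ D

  balanced? : ∀ {n} (v : Vec (Fin l) n) → Dec (Balanced v)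
  balanced? v = all? (λ a → R * count (Excess a v) ≤? D)

  Bounded : ∀ {n} → Vec (Fin l) n → Set
  Bounded {n} v = n * D + R * count (⋂ v) ≤ suc R * D

  ⋂-shrink : ∀ {n} a (v : Vec (Fin l) n) → count (⋂ (a ∷ v)) + count (Excess a v) ≡ count (⋂ v)
  ⋂-shrink a v = count-split (A a) (⋂ v)

  -- Prepending an index shrinks every excess, so balance is preserved.
  balanced-∷ : ∀ {n} i (v : Vec (Fin l) n) → Balanced v → Balanced (i ∷ v)
  balanced-∷ i v bal a = ≤-trans (*-monoʳ-≤ R (Σ-Fin-mono _ _ pointwise)) (bal a)
    where
    pointwise : ∀ j → ind (Excess a (i ∷ v) j) ≤ ind (Excess a v j)
    pointwise j with A i j
    ... | true  = ≤-refl
    ... | false = z≤n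

  bounded-[_] : ∀ i → Bounded (i ∷ [])
  bounded-[ i ] = +-mono-≤ (≤-reflexive (+-identityʳ D)) (*-monoʳ-≤ R size)
    where
    size : count (⋂ (i ∷ [])) ≤ D
    size = ≤-trans (≤-reflexive (Σ-Fin-cong _ _ (λ j → cong ind (∧-identityʳ (A i j))))) (small i)

  bounded-∷ : ∀ {n} a (v : Vec (Fin l) n) → Bounded v → ¬ (R * count (Excess a v) ≤ D) →
    Bounded (a ∷ v)
  bounded-∷ {n} a v bnd unbalanced = begin
      (D + n * D) + X   ≡⟨ trans (cong (_+ X) (+-comm D (n * D))) (+-assoc (n * D) D X) ⟩
      n * D + (D + X)   ≤⟨ +-monoʳ-≤ (n * D) (+-monoˡ-≤ X (<⇒≤ (≰⇒> unbalanced))) ⟩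
      n * D + (Y + X)   ≡⟨ cong (n * D +_) removed ⟩
      n * D + R * count (⋂ v) ≤⟨ bnd ⟩
      suc R * D         ∎
    where
    open ≤-Reasoning
    X = R * count (⋂ (a ∷ v))
    Y = R * count (Excess a v)
    removed : Y + X ≡ R * count (⋂ v)
    removed = trans (+-comm Y X) (trans (sym (*-distribˡ-+ R _ _)) (cong (R *_) (⋂-shrink a v)))

  -- With R + 1 indices the invariant forces R · |I| = 0, so every excess vanishes.
  bounded⇒balanced : (v : Vec (Fin l) (suc R)) → Bounded v → Balanced v
  bounded⇒balanced v bnd a = ≤-trans (*-monoʳ-≤ R excess≤⋂) (≤-trans ⋂≤0 z≤n)
    where
    excess≤⋂ : count (Excess a v) ≤ count (⋂ v)
    excess≤⋂ = subst (count (Excess a v) ≤_) (⋂-shrink a v) (m≤n+m _ _)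
    ⋂≤0 : R * count (⋂ v) ≤ 0
    ⋂≤0 = +-cancelˡ-≤ (suc R * D) _ 0 (subst (suc R * D + R * count (⋂ v) ≤_) (sym (+-identityʳ (suc R * D))) bnd)

  search : (i₀ : Fin l) (n : ℕ) → Σ (Vec (Fin l) (suc n)) (λ v → Bounded v ⊎ Balanced v)
  search i₀ zero = i₀ ∷ [] , inj₁ bounded-[ i₀ ]
  search i₀ (suc n) with search i₀ n
  ... | v , inj₂ bal = i₀ ∷ v , inj₂ (balanced-∷ i₀ v bal)
  ... | v , inj₁ bnd with balanced? v
  ...   | yes bal = i₀ ∷ v , inj₂ (balanced-∷ i₀ v bal)
  ...   | no ¬bal with ¬∀⟶∃¬ l _ (λ a → R * count (Excess a v) ≤? D) ¬bal
  ...     | a , unbalanced = a ∷ v , inj₁ (bounded-∷ a v bnd unbalanced)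

  select : Fin l → Σ (Vec (Fin l) (suc R)) Balanced
  select i₀ with search i₀ R
  ... | v , inj₁ bnd = v , bounded⇒balanced v bnd
  ... | v , inj₂ bal = v , bal

  ⋂-intro : ∀ {n} (v : Vec (Fin l) n) j → (∀ k → A (lookup v k) j ≡ true) → ⋂ v j ≡ true
  ⋂-intro []      j all = refl
  ⋂-intro (i ∷ v) j all rewrite all Fin.zero = ⋂-intro v j (λ k → all (Fin.suc k))

xor-via : ∀ a b c → a xor b ≡ (a xor c) xor (b xor c)
xor-via a b c = sym (begin
    (a xor c) xor (b xor c)   ≡⟨ xor-assoc a c (b xor c) ⟩
    a xor (c xor (b xor c))   ≡⟨ cong (λ t → a xor (c xor t)) (xor-comm b c) ⟩
    a xor (c xor (c xor b))   ≡⟨ cong (a xor_) (sym (xor-assoc c c b)) ⟩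
    a xor ((c xor c) xor b)   ≡⟨ cong (λ t → a xor (t xor b)) (xor-same c) ⟩
    a xor b                   ∎)
  where open ≡-Reasoning

xor-defect : ∀ u w e → (w ≡ true → e ≡ true) → ind (u xor w) ≤ ind u + ind (e ∧ not u)
xor-defect true  true  e forces = z≤n
xor-defect true  false e forces = s≤s z≤n
xor-defect false false e forces = z≤n
xor-defect false true  e forces rewrite forces refl = s≤s z≤n

dHP-triangle-with-defect : ∀ {m} (P : Subset m) (x z c : BinVec m) (E : Fin m → Bool) →
  (∀ j → lookup P j ≡ true → (z j xor c j) ≡ true → E j ≡ true) →
  dHP P x z ≤ dHP P x c + count (λ j → E j ∧ not (x j xor c j))
dHP-triangle-with-defect P x z c E forces =
  ≤-trans (Σ-Fin-mono _ _ (λ j → pointwise (lookup P j) (x j) (z j) (c j) (E j) (forces j)))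
          (≤-reflexive (Σ-Fin-+ (λ j → ind (lookup P j ∧ (x j xor c j))) (λ j → ind (E j ∧ not (x j xor c j)))))
  where
  pointwise : ∀ p a b c e → (p ≡ true → (b xor c) ≡ true → e ≡ true) →
    ind (p ∧ (a xor b)) ≤ ind (p ∧ (a xor c)) + ind (e ∧ not (a xor c))
  pointwise false a b c e _      = z≤n
  pointwise true  a b c e forces =
    subst (λ t → ind t ≤ _) (sym (xor-via a b c)) (xor-defect (a xor c) (b xor c) e (forces refl))

lemma3 : (m l : ℕ) → 1 ≤ l → (y : Fin l → BinVec m) → (c : BinVec m) →
    (r : ℕ) → (r>2 : 2 < r) →
    Σ (Fin r → Fin l) λ ι →
      (a : Fin l) → (P : Subset m) →
      ((j : Fin m) → j ∈ P → InQ y ι (fromℕ< (≤-trans (s≤s z≤n) r>2)) j) →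
      (r ∸ 1) * dHP P (y a) (y (ι (fromℕ< (≤-trans (s≤s z≤n) r>2))))
        ≤ (r ∸ 1) * dHP P (y a) c + max-Fin (λ i → dH (y i) c)
lemma3 m (suc l) (s≤s z≤n) y c (suc R) r>2 = lookup v , bound
  where
  A : Fin (suc l) → Fin m → Bool
  A i j = y i j xor c j
  D : ℕ
  D = max-Fin (λ i → dH (y i) c)
  open GreedySelection A D R (λ i → subst (_≤ D) (dH-as-count (y i) c) (max-Fin-≥ (λ i → dH (y i) c) i))
  v : Vec (Fin (suc l)) (suc R)
  v = proj₁ (select Fin.zero)

  covered : ∀ P → (∀ j → j ∈ P → InQ y (lookup v) Fin.zero j) →
    ∀ j → lookup P j ≡ true → A (lookup v Fin.zero) j ≡ true → ⋂ v j ≡ true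
  covered P inQ j j∈P differs =
    ⋂-intro v j (λ k → subst (λ b → (b xor c j) ≡ true) (sym (inQ j (lookup⇒[]= j P j∈P) k)) differs)

  bound : ∀ a P → (∀ j → j ∈ P → InQ y (lookup v) Fin.zero j) →
    R * dHP P (y a) (y (lookup v Fin.zero)) ≤ R * dHP P (y a) c + D
  bound a P inQ = begin
      R * dHP P (y a) (y i₀)
    ≤⟨ *-monoʳ-≤ R (dHP-triangle-with-defect P (y a) (y i₀) c (⋂ v) (covered P inQ)) ⟩
      R * (dHP P (y a) c + count (Excess a v))
    ≡⟨ *-distribˡ-+ R _ _ ⟩
      R * dHP P (y a) c + R * count (Excess a v)
    ≤⟨ +-monoʳ-≤ (R * dHP P (y a) c) (proj₂ (select Fin.zero) a) ⟩
      R * dHP P (y a) c + D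
    ∎
    where
    open ≤-Reasoning
    i₀ : Fin (suc l)
    i₀ = lookup v Fin.zero
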